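{- If $G$ is a finite abelian group, then $\overrightarrow{\mathrm{Endo}}(G)$ has a single point basis, i.e., there is a vertex $g \in G$ from which every other vertex of $\overrightarrow{\mathrm{Endo}}(G)$ is reachable by a directed path. The converse does not hold: there exists a finite non-abelian group $G$ for which $\overrightarrow{\mathrm{Endo}}(G)$ has a single point basis.
   Context: For a finite group $G$, $\overrightarrow{\mathrm{Endo}}(G)$ is the directed graph with vertex set $G$ and an arc from $a$ to $b$ ($a\ne b$) iff some group endomorphism $f$ of $G$ satisfies $f(a)=b$. A point basis of a digraph is a minimal set of vertices from which all other vertices are reachable by directed paths; a single point basis is a point basis consisting of one vertex. -}

module Defs where

open import Level using (0ℓ)
open import Data.Nat using (ℕ)
open import Data.Fin using (Fin)
open import Data.Product using (∃; ∃-syntax; _×_)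
open import Relation.Binary.PropositionalEquality using (_≡_; _≢_)
open import Relation.Binary.Construct.Closure.ReflexiveTransitive using (Star)
open import Algebra.Structures using (IsGroup)
open import Algebra.Bundles.Raw using (RawGroup)
open import Algebra.Morphism.Structures using (module GroupMorphisms)

-- A finite group, encoded (up to isomorphism) as a group structure on
-- Fin order, with propositional equality as the group's equality.
record FiniteGroup : Set where
  infixl 7 _∙_
  infix  8 _⁻¹
  field
    order   : ℕ
    _∙_     : Fin order → Fin order → Fin order
    ε       : Fin order
    _⁻¹     : Fin order → Fin order
    isGroup : IsGroup _≡_ _∙_ ε _⁻¹

  rawGroup : RawGroup 0ℓ 0ℓ
  rawGroup = record { Carrier = Fin order ; _≈_ = _≡_ ; _∙_ = _∙_ ; ε = ε ; _⁻¹ = _⁻¹ }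

module _ (G : FiniteGroup) where
  open FiniteGroup G
  open GroupMorphisms rawGroup rawGroup

  IsAbelian : Set
  IsAbelian = ∀ x y → x ∙ y ≡ y ∙ x

  IsEndomorphism : (Fin order → Fin order) → Set
  IsEndomorphism f = IsGroupHomomorphism f

  EndoArc : Fin order → Fin order → Set
  EndoArc a b = a ≢ b × ∃[ f ] (IsEndomorphism f × f a ≡ b)

  Reachable : Fin order → Fin order → Set
  Reachable = Star EndoArc

  HasSinglePointBasis : Set
  HasSinglePointBasis = ∃[ g ] (∀ h → h ≢ g → Reachable g h)

-- Choose g whose order n = ord g is a multiple of every element order: elements of orders
-- p ^ α * r and p ^ β * s (p ∤ r s) yield, by induction on the p-free parts, one of order
-- lcm r s * p ^ (α ⊔ β).  The identity of ⟨g⟩ then extends, one element at a time, to a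
-- homomorphism ρ : G → ⟨g⟩: to adjoin x to the subgroup H already covered, let m be the order
-- of x modulo H; as x ^ n = ε, ρ (x ^ m) has an m-th root c in ⟨g⟩, and ρ extends to H⟨x⟩ by
-- x ↦ c.  Writing ρ y = g ^ log y, every h is the image of g under y ↦ h ^ log y, which is an
-- endomorphism because h ^ n = ε.  In the dihedral group of order 8 the rotation r is sent to
-- r ⁻¹ by conjugation with a reflection, and to every t with t ∙ t = ε through ℤ/2.

module Submission where

open import Defs

open import Level using (Level; 0ℓ)
open import Function using (_∘_)
open import Algebra.Bundles using (Group; AbelianGroup)
import Algebra.Properties.Group as GroupProperties
import Algebra.Properties.CommutativeSemigroup as CommutativeSemigroupProperties
import Algebra.Properties.Monoid.Mult as MonoidMult
import Algebra.Properties.CommutativeMonoid.Mult as CommutativeMonoidMult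
open import Data.Product using (_×_; _,_; proj₁; proj₂; ∃₂; ∃-syntax)
open import Data.Sum using (_⊎_; inj₁; inj₂; [_,_]′)
open import Data.Fin using (Fin; toℕ)
open import Data.Fin.Properties using (pigeonhole; any?) renaming (_≟_ to _≟ᶠ_)
open import Data.List using ([]; _∷_; allFin)
open import Data.List.Relation.Unary.All as All using (All; []; _∷_)
open import Data.List.Membership.Propositional.Properties using (∈-allFin)
open import Data.Nat.Base as ℕ
  using (ℕ; zero; suc; _+_; _*_; _<_; _≤_; _⊔_; NonZero; pred; s≤s; s<s⁻¹; z<s;
         ≢-nonZero⁻¹; nonTrivial⇒n>1)
open import Data.Nat.Properties
  using (≤-refl; ≤-total; +-comm; +-suc; *-comm; *-assoc; *-identityˡ; *-identityʳ; *-zeroʳ;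
         *-distribˡ-+; m*n≢0⇒m≢0; m<m*n; suc-pred; ^-distribˡ-+-*; ^-monoʳ-<;
         m≤n⇒∃[o]m+o≡n; ⊔-sel; m≤m⊔n; m≤n⊔m; anyUpTo?)
open import Data.Nat.Divisibility
open import Data.Nat.DivMod using (_%_; _/_; m≡m%n+[m/n]*n; m%n<n)
open import Data.Nat.Coprimality as Coprimality using (Coprime; coprime-divisor; 1-coprimeTo)
open import Data.Nat.Primality using (Prime; euclidsLemma; prime⇒irreducible; prime⇒nonTrivial)
open import Data.Nat.Primality.Factorisation using (factorise)
open import Data.Nat.ListAction using (product)
open import Data.Nat.LCM using (LCM)
open import Data.Nat.Induction using (<-wellFounded)
open import Induction.WellFounded using (Acc; acc)
open import Relation.Nullary using (¬_; yes; no; contradiction)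
open import Relation.Nullary.Decidable using (map′; _×-dec_)
open import Relation.Unary using (Pred; Decidable; _⊆_; _≐_)
open import Relation.Binary.PropositionalEquality
open import Relation.Binary.Consequences using (wlog)
open import Relation.Binary.Construct.Closure.ReflexiveTransitive as Star using (_◅_)

module NatProperties where

  open import Data.Nat.Base using (_^_)

  private
    variable
      ℓ : Level
      m n p r s l : ℕ

  least-witness : {P : Pred ℕ ℓ} → Decidable P →
                  ∀ {n} → P n → ∃[ m ] (P m × ∀ {k} → k < m → ¬ P k)
  least-witness P? {n} Pn with P? 0
  ... | yes P0 = 0 , P0 , λ ()
  least-witness P? {zero} P0 | no ¬P0 = contradiction P0 ¬P0
  least-witness P? {suc n} Pn | no ¬P0 with least-witness (P? ∘ suc) Pn
  ... | m , Psm , minimal = suc m , Psm , λ { {zero} _ → ¬P0 ; {suc k} k<m → minimal (s<s⁻¹ k<m) }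

  module _ {P : Pred ℕ ℓ} (P? : Decidable P)
           (+-closed : ∀ {a b} → P a → P b → P (a + b))
           (∸-closed : ∀ {a b} → P (a + b) → P b → P a) where

    -- The least positive element generates P, since P is closed under remainders.
    ≐-multiples : ∀ {n} → P (suc n) → ∃[ m ] (NonZero m × P ≐ (m ∣_))
    ≐-multiples P1+n with least-witness (P? ∘ suc) P1+n
    ... | m , P1+m , minimal = suc m , _ , divisible , multiple
      where
      multiple : (suc m ∣_) ⊆ P
      multiple (divides zero refl) = ∸-closed P1+m P1+m
      multiple (divides (suc q) refl) = +-closed P1+m (multiple (divides q refl))

      divisible : P ⊆ (suc m ∣_)
      divisible {k} Pk = m%n≡0⇒n∣m k (suc m) (remainder≡0 (k % suc m) (m%n<n k (suc m)) P[k%1+m])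
        where
        P[k%1+m] : P (k % suc m)
        P[k%1+m] = ∸-closed (subst P (m≡m%n+[m/n]*n k (suc m)) Pk) (multiple (n∣m*n (k / suc m)))
        remainder≡0 : ∀ i → i < suc m → P i → i ≡ 0
        remainder≡0 zero _ _ = refl
        remainder≡0 (suc i) i<m Pi = contradiction Pi (minimal (s<s⁻¹ i<m))

  prime⇒1<p : Prime p → 1 < p
  prime⇒1<p {p} p-prime = nonTrivial⇒n>1 p {{prime⇒nonTrivial p-prime}}

  one-or-prime-factor : ∀ n → .{{NonZero n}} → n ≡ 1 ⊎ ∃[ p ] (Prime p × p ∣ n)
  one-or-prime-factor n with factorise n
  ... | record { factors = [] ; isFactorisation = n≡1 } = inj₁ n≡1
  ... | record { factors = p ∷ ps ; isFactorisation = n≡p*ps ; factorsPrime = p-prime ∷ _ } =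
    inj₂ (p , p-prime , divides (product ps) (trans n≡p*ps (*-comm p _)))

  p-part-split : Prime p → ∀ n → .{{NonZero n}} → ∃₂ λ α r → p ∤ r × n ≡ p ^ α * r
  p-part-split {p} p-prime n = split n (<-wellFounded n)
    where
    split : ∀ n → .{{NonZero n}} → Acc _<_ n → ∃₂ λ α r → p ∤ r × n ≡ p ^ α * r
    split n (acc smaller) with p ∣? n
    ... | no p∤n = 0 , n , p∤n , sym (*-identityˡ n)
    ... | yes (divides zero n≡0) = contradiction n≡0 (≢-nonZero⁻¹ n)
    ... | yes (divides q@(suc _) n≡q*p) with split q (smaller q<n)
      where
      q<n : q < n
      q<n = subst (q <_) (sym n≡q*p) (m<m*n q p (prime⇒1<p p-prime))
    ...   | α , r , p∤r , q≡pᵅr = suc α , r , p∤r , (begin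
      n              ≡⟨ n≡q*p ⟩
      q * p          ≡⟨ cong (_* p) q≡pᵅr ⟩
      p ^ α * r * p  ≡⟨ *-comm _ p ⟩
      p * (p ^ α * r) ≡⟨ *-assoc p _ r ⟨
      p ^ suc α * r  ∎)
      where open ≡-Reasoning

  p-free-part-< : Prime p → p ∣ n → p ∤ s → ∀ β → n ≡ p ^ β * s → .{{NonZero n}} → s < n
  p-free-part-< {s = s} p-prime p∣n p∤s zero n≡s =
    contradiction (subst (_ ∣_) (trans n≡s (*-identityˡ s)) p∣n) p∤s
  p-free-part-< {p} {n} {zero} p-prime p∣n p∤s (suc β) n≡0 =
    contradiction (trans n≡0 (*-zeroʳ (p ^ suc β))) (≢-nonZero⁻¹ n)
  p-free-part-< {p} {s = s@(suc _)} p-prime p∣n p∤s (suc β) n≡pᵝs =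
    subst (s <_) (trans (*-comm s _) (sym n≡pᵝs))
      (m<m*n s (p ^ suc β) (^-monoʳ-< p (prime⇒1<p p-prime) {0} {suc β} z<s))

  ^-monoʳ-∣ : ∀ p {m n} → m ≤ n → p ^ m ∣ p ^ n
  ^-monoʳ-∣ p {m} m≤n with m≤n⇒∃[o]m+o≡n m≤n
  ... | o , refl = divides (p ^ o) (trans (^-distribˡ-+-* p m o) (*-comm (p ^ m) (p ^ o)))

  ∤⇒coprime : Prime p → p ∤ n → Coprime n p
  ∤⇒coprime p-prime p∤n (d∣n , d∣p) with prime⇒irreducible p-prime d∣p
  ... | inj₁ d≡1 = d≡1
  ... | inj₂ refl = contradiction d∣n p∤n

  coprime-* : ∀ {a b} → Coprime n a → Coprime n b → Coprime n (a * b)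
  coprime-* n⊥a n⊥b (d∣n , d∣ab) =
    n⊥b (d∣n , coprime-divisor (λ (e∣d , e∣a) → n⊥a (∣-trans e∣d d∣n , e∣a)) d∣ab)

  ∤⇒coprime-^ : Prime p → p ∤ n → ∀ k → Coprime n (p ^ k)
  ∤⇒coprime-^ p-prime p∤n zero = Coprimality.sym (1-coprimeTo _)
  ∤⇒coprime-^ p-prime p∤n (suc k) =
    coprime-* (∤⇒coprime p-prime p∤n) (∤⇒coprime-^ p-prime p∤n k)

  coprime⇒*-∣ : ∀ {c} → Coprime m n → m ∣ c → n ∣ c → m * n ∣ c
  coprime⇒*-∣ {m} {n} m⊥n (divides q refl) n∣qm =
    subst (_∣ q * m) (*-comm n m)
      (*-monoˡ-∣ m (coprime-divisor (Coprimality.sym m⊥n) (subst (n ∣_) (*-comm q m) n∣qm)))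

  ∤-lcm : Prime p → p ∤ r → p ∤ s → LCM r s l → p ∤ l
  ∤-lcm {r = r} {s} p-prime p∤r p∤s r∨s≡l p∣l =
    [ p∤r , p∤s ]′
      (euclidsLemma r s p-prime (∣-trans p∣l (LCM.least r∨s≡l (m∣m*n s , n∣m*n r))))

  lcm-split : Prime p → p ∤ r → p ∤ s → LCM r s l →
              ∀ α β → LCM (p ^ α * r) (p ^ β * s) (l * p ^ (α ⊔ β))
  lcm-split {p} {r} {s} {l} p-prime p∤r p∤s r∨s≡l α β = record
    { commonMultiple = p-and-free (m≤m⊔n α β) r∣l , p-and-free (m≤n⊔m α β) s∣l
    ; least = λ (pᵅr∣c , pᵝs∣c) →
        coprime⇒*-∣ (∤⇒coprime-^ p-prime (∤-lcm p-prime p∤r p∤s r∨s≡l) (α ⊔ β))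
          (LCM.least r∨s≡l
            (∣-trans (n∣m*n (p ^ α)) pᵅr∣c , ∣-trans (n∣m*n (p ^ β)) pᵝs∣c))
          (p-part (∣-trans (m∣m*n r) pᵅr∣c) (∣-trans (m∣m*n s) pᵝs∣c))
    }
    where
    r∣l : r ∣ l
    r∣l = proj₁ (LCM.commonMultiple r∨s≡l)
    s∣l : s ∣ l
    s∣l = proj₂ (LCM.commonMultiple r∨s≡l)

    p-and-free : ∀ {δ t} → δ ≤ α ⊔ β → t ∣ l → p ^ δ * t ∣ l * p ^ (α ⊔ β)
    p-and-free {δ} {t} δ≤γ t∣l =
      subst (p ^ δ * t ∣_) (*-comm (p ^ (α ⊔ β)) l) (*-pres-∣ (^-monoʳ-∣ p δ≤γ) t∣l)

    p-part : ∀ {c} → p ^ α ∣ c → p ^ β ∣ c → p ^ (α ⊔ β) ∣ c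
    p-part pᵅ∣c pᵝ∣c with ⊔-sel α β
    ... | inj₁ γ≡α = subst (λ γ → p ^ γ ∣ _) (sym γ≡α) pᵅ∣c
    ... | inj₂ γ≡β = subst (λ γ → p ^ γ ∣ _) (sym γ≡β) pᵝ∣c

open NatProperties

module FiniteGroupProperties (G : FiniteGroup) where

  open FiniteGroup G

  group : Group 0ℓ 0ℓ
  group = record { isGroup = isGroup }

  open Group group using (monoid; identityˡ; identityʳ; inverseˡ)
  open GroupProperties group
    using (∙-cancelˡ; inverseˡ-unique; inverseʳ-unique; //-rightDividesʳ)
  private
    module Mult = MonoidMult monoid

  infixr 8 _^_
  _^_ : Fin order → ℕ → Fin order
  x ^ k = k Mult.× x

  ^-homo-∙ : ∀ x m n → x ^ (m + n) ≡ x ^ m ∙ x ^ n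
  ^-homo-∙ x m n = Mult.×-homo-+ x m n

  ^-assocʳ : ∀ x m n → (x ^ m) ^ n ≡ x ^ (m * n)
  ^-assocʳ x m n = trans (Mult.×-assocˡ x n m) (cong (x ^_) (*-comm n m))

  ^-cancel : ∀ x i d → x ^ i ≡ x ^ (i + d) → x ^ d ≡ ε
  ^-cancel x i d x^i≡x^[i+d] =
    sym (∙-cancelˡ (x ^ i) ε (x ^ d) (trans (identityʳ _) (trans x^i≡x^[i+d] (^-homo-∙ x i d))))

  ^-absorb : ∀ x i d → x ^ d ≡ ε → x ^ (i + d) ≡ x ^ i
  ^-absorb x i d x^d≡ε = trans (^-homo-∙ x i d) (trans (cong (x ^ i ∙_) x^d≡ε) (identityʳ _))

  private
    power-returns-to-ε : ∀ x → ∃[ d ] x ^ suc d ≡ ε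
    power-returns-to-ε x with pigeonhole (s≤s ≤-refl) (λ (i : Fin (suc order)) → x ^ toℕ i)
    ... | i , j , i<j , x^i≡x^j with d , 1+i+d≡j ← m≤n⇒∃[o]m+o≡n i<j =
      d , ^-cancel x (toℕ i) (suc d)
            (trans x^i≡x^j (cong (x ^_) (sym (trans (+-suc (toℕ i) d) 1+i+d≡j))))

  abstract
    order-multiples : ∀ x → ∃[ m ] (NonZero m × (λ k → x ^ k ≡ ε) ≐ (m ∣_))
    order-multiples x = ≐-multiples (λ k → x ^ k ≟ᶠ ε)
      (λ {a} {b} x^a≡ε x^b≡ε → trans (^-absorb x a b x^b≡ε) x^a≡ε)
      (λ {a} {b} x^[a+b]≡ε x^b≡ε → trans (sym (^-absorb x a b x^b≡ε)) x^[a+b]≡ε)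
      {proj₁ (power-returns-to-ε x)} (proj₂ (power-returns-to-ε x))

  ord : Fin order → ℕ
  ord x = proj₁ (order-multiples x)

  instance
    ord-nonZero : ∀ {x} → NonZero (ord x)
    ord-nonZero {x} = proj₁ (proj₂ (order-multiples x))

  ^≡ε⇒ord∣ : ∀ x k → x ^ k ≡ ε → ord x ∣ k
  ^≡ε⇒ord∣ x k = proj₁ (proj₂ (proj₂ (order-multiples x)))

  ord∣⇒^≡ε : ∀ x k → ord x ∣ k → x ^ k ≡ ε
  ord∣⇒^≡ε x k = proj₂ (proj₂ (proj₂ (order-multiples x)))

  ^-ord : ∀ x → x ^ ord x ≡ ε
  ^-ord x = ord∣⇒^≡ε x (ord x) ∣-refl

  ^-mod-ord : ∀ x j → x ^ j ≡ x ^ (j % ord x)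
  ^-mod-ord x j = trans (cong (x ^_) (m≡m%n+[m/n]*n j (ord x)))
    (^-absorb x (j % ord x) _ (ord∣⇒^≡ε x _ (n∣m*n (j / ord x))))

  ^-suc-pred-ord : ∀ x → x ^ suc (pred (ord x)) ≡ ε
  ^-suc-pred-ord x = trans (cong (x ^_) (suc-pred (ord x))) (^-ord x)

  ⁻¹≡^pred-ord : ∀ x → x ⁻¹ ≡ x ^ pred (ord x)
  ⁻¹≡^pred-ord x = sym (inverseʳ-unique x _ (^-suc-pred-ord x))

  ord-^ : ∀ x d {e} → ord x ≡ d * e → ord (x ^ d) ≡ e
  ord-^ x d {e} ord-x≡de = ∣-antisym
    (^≡ε⇒ord∣ (x ^ d) e (trans (^-assocʳ x d e) (trans (cong (x ^_) (sym ord-x≡de)) (^-ord x))))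
    (*-cancelˡ-∣ d {{d≢0}} (subst (_∣ d * ord (x ^ d)) ord-x≡de
      (^≡ε⇒ord∣ x (d * ord (x ^ d)) (trans (sym (^-assocʳ x d _)) (^-ord (x ^ d))))))
    where
    d≢0 : NonZero d
    d≢0 = m*n≢0⇒m≢0 d {{subst NonZero ord-x≡de ord-nonZero}}

  ^-transfer : ∀ x y → ord y ∣ ord x → ∀ i j → x ^ i ≡ x ^ j → y ^ i ≡ y ^ j
  ^-transfer x y y∣x = wlog {Q = λ i j → x ^ i ≡ x ^ j → y ^ i ≡ y ^ j}
    ≤-total (λ transfer x^j≡x^i → sym (transfer (sym x^j≡x^i))) transfer≤
    where
    transfer≤ : ∀ i j → i ≤ j → x ^ i ≡ x ^ j → y ^ i ≡ y ^ j
    transfer≤ i j i≤j x^i≡x^j with d , refl ← m≤n⇒∃[o]m+o≡n i≤j =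
      sym (^-absorb y i d
        (ord∣⇒^≡ε y d (∣-trans y∣x (^≡ε⇒ord∣ x d (^-cancel x i d x^i≡x^j)))))

  homo⇒isEndomorphism : ∀ {f} → (∀ a b → f (a ∙ b) ≡ f a ∙ f b) → IsEndomorphism G f
  homo⇒isEndomorphism {f} homo = record
    { isMonoidHomomorphism = record
      { isMagmaHomomorphism = record
        { isRelHomomorphism = record { cong = cong f }
        ; homo = homo
        }
      ; ε-homo = ε-homo
      }
    ; ⁻¹-homo = λ a → inverseˡ-unique (f (a ⁻¹)) (f a)
        (trans (sym (homo (a ⁻¹) a)) (trans (cong f (inverseˡ a)) ε-homo))
    }
    where
    ε-homo : f ε ≡ ε
    ε-homo = ∙-cancelˡ (f ε) (f ε) ε
      (trans (sym (homo ε ε)) (trans (cong f (identityˡ ε)) (sym (identityʳ (f ε)))))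

  -- In a finite group these are the decidable subgroups (see ⁻¹-closed).
  record DecSubmonoid : Set₁ where
    field
      member   : Pred (Fin order) 0ℓ
      member?  : Decidable member
      ε-closed : member ε
      ∙-closed : ∀ {a b} → member a → member b → member (a ∙ b)

    ^-closed : ∀ {a} → member a → ∀ k → member (a ^ k)
    ^-closed a∈ zero = ε-closed
    ^-closed a∈ (suc k) = ∙-closed a∈ (^-closed a∈ k)

    ⁻¹-closed : ∀ {a} → member a → member (a ⁻¹)
    ⁻¹-closed {a} a∈ = subst member (sym (⁻¹≡^pred-ord a)) (^-closed a∈ (pred (ord a)))

  open DecSubmonoid public

  infix 4 _∈_
  _∈_ : Fin order → DecSubmonoid → Set
  a ∈ H = member H a

  relative-order : ∀ H x → ∃[ m ] (NonZero m × (λ k → x ^ k ∈ H) ≐ (m ∣_))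
  relative-order H x = ≐-multiples (λ k → member? H (x ^ k))
    (λ {a} {b} x^a∈H x^b∈H → subst (_∈ H) (sym (^-homo-∙ x a b)) (∙-closed H x^a∈H x^b∈H))
    (λ {a} {b} x^[a+b]∈H x^b∈H → subst (_∈ H) (x^a≡ a b)
      (∙-closed H x^[a+b]∈H (⁻¹-closed H x^b∈H)))
    {pred (ord x)} (subst (_∈ H) (sym (^-suc-pred-ord x)) (ε-closed H))
    where
    x^a≡ : ∀ a b → x ^ (a + b) ∙ (x ^ b) ⁻¹ ≡ x ^ a
    x^a≡ a b = trans (cong (_∙ (x ^ b) ⁻¹) (^-homo-∙ x a b)) (//-rightDividesʳ (x ^ b) (x ^ a))

module FiniteAbelianGroupProperties (G : FiniteGroup) (comm : IsAbelian G) where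

  open FiniteGroup G
  open FiniteGroupProperties G

  abelianGroup : AbelianGroup 0ℓ 0ℓ
  abelianGroup = record { isAbelianGroup = record { isGroup = isGroup ; comm = comm } }

  open AbelianGroup abelianGroup
    using (assoc; identityˡ; identityʳ; commutativeMonoid; commutativeSemigroup)
  open GroupProperties group using (∙-cancelˡ; ∙-cancelʳ; \\-leftDividesʳ)
  open CommutativeSemigroupProperties commutativeSemigroup using (interchange)

  ^-distrib-∙ : ∀ x y k → (x ∙ y) ^ k ≡ x ^ k ∙ y ^ k
  ^-distrib-∙ x y k = CommutativeMonoidMult.×-distrib-+ commutativeMonoid x y k

  ord∣ord∙*ord : ∀ x y → ord x ∣ ord (x ∙ y) * ord y
  ord∣ord∙*ord x y = ^≡ε⇒ord∣ x k (begin
    x ^ k                ≡⟨ identityʳ (x ^ k) ⟨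
    x ^ k ∙ ε            ≡⟨ cong (x ^ k ∙_) (ord∣⇒^≡ε y k (n∣m*n (ord (x ∙ y)))) ⟨
    x ^ k ∙ y ^ k        ≡⟨ ^-distrib-∙ x y k ⟨
    (x ∙ y) ^ k          ≡⟨ ord∣⇒^≡ε (x ∙ y) k (m∣m*n (ord y)) ⟩
    ε                    ∎)
    where
    open ≡-Reasoning
    k : ℕ
    k = ord (x ∙ y) * ord y

  ord-∙-coprime : ∀ x y → Coprime (ord x) (ord y) → ord (x ∙ y) ≡ ord x * ord y
  ord-∙-coprime x y x⊥y = ∣-antisym
    (^≡ε⇒ord∣ (x ∙ y) k (begin
      (x ∙ y) ^ k        ≡⟨ ^-distrib-∙ x y k ⟩
      x ^ k ∙ y ^ k      ≡⟨ cong₂ _∙_ (ord∣⇒^≡ε x k (m∣m*n (ord y))) (ord∣⇒^≡ε y k (n∣m*n (ord x))) ⟩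
      ε ∙ ε              ≡⟨ identityˡ ε ⟩
      ε                  ∎))
    (coprime⇒*-∣ x⊥y
      (coprime-divisor x⊥y (subst (ord x ∣_) (*-comm _ (ord y)) (ord∣ord∙*ord x y)))
      (coprime-divisor (Coprimality.sym x⊥y)
        (subst (λ z → ord y ∣ z) (trans (cong (λ z → ord z * ord x) (comm y x)) (*-comm _ (ord x)))
          (ord∣ord∙*ord y x))))
    where
    open ≡-Reasoning
    k : ℕ
    k = ord x * ord y

  prime-power-element : ∀ {r s} x y p α β → ord x ≡ p ℕ.^ α * r → ord y ≡ p ℕ.^ β * s →
                        ∃[ w ] ord w ≡ p ℕ.^ (α ⊔ β)
  prime-power-element {r} {s} x y p α β ord-x≡ ord-y≡ with ⊔-sel α β
  ... | inj₁ γ≡α =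
    x ^ r , trans (ord-^ x r (trans ord-x≡ (*-comm _ r))) (cong (p ℕ.^_) (sym γ≡α))
  ... | inj₂ γ≡β =
    y ^ s , trans (ord-^ y s (trans ord-y≡ (*-comm _ s))) (cong (p ℕ.^_) (sym γ≡β))

  lcm-order-step : ∀ {p r s} x y z α β → Prime p → p ∤ r → p ∤ s →
                   ord x ≡ p ℕ.^ α * r → ord y ≡ p ℕ.^ β * s → LCM r s (ord z) →
                   ∃[ z′ ] LCM (ord x) (ord y) (ord z′)
  lcm-order-step {p} x y z α β p-prime p∤r p∤s ord-x≡ ord-y≡ r∨s≡z
    with w , ord-w≡ ← prime-power-element x y p α β ord-x≡ ord-y≡ =
    z ∙ w , subst₂ (λ a b → LCM a b _) (sym ord-x≡) (sym ord-y≡)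
              (subst (LCM _ _) (sym ord-z∙w≡) (lcm-split p-prime p∤r p∤s r∨s≡z α β))
    where
    ord-z∙w≡ : ord (z ∙ w) ≡ ord z * p ℕ.^ (α ⊔ β)
    ord-z∙w≡ = trans
      (ord-∙-coprime z w (subst (Coprime (ord z)) (sym ord-w≡)
        (∤⇒coprime-^ p-prime (∤-lcm p-prime p∤r p∤s r∨s≡z) (α ⊔ β))))
      (cong (ord z *_) ord-w≡)

  ∃-lcm-order : ∀ x y → ∃[ z ] LCM (ord x) (ord y) (ord z)
  ∃-lcm-order x y = go x y (<-wellFounded (ord y))
    where
    go : ∀ x y → Acc _<_ (ord y) → ∃[ z ] LCM (ord x) (ord y) (ord z)
    go x y (acc smaller) with one-or-prime-factor (ord y)
    ... | inj₁ ord-y≡1 = x , record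
      { commonMultiple = ∣-refl , subst (_∣ ord x) (sym ord-y≡1) (1∣ ord x)
      ; least = proj₁
      }
    ... | inj₂ (p , p-prime , p∣ord-y)
      with α , r , p∤r , ord-x≡ ← p-part-split p-prime (ord x)
         | β , s , p∤s , ord-y≡ ← p-part-split p-prime (ord y)
      with z , r∨s≡z ← go (x ^ p ℕ.^ α) (y ^ p ℕ.^ β)
             (smaller (subst (_< ord y) (sym (ord-^ y (p ℕ.^ β) ord-y≡))
                               (p-free-part-< p-prime p∣ord-y p∤s β ord-y≡)))
      = lcm-order-step x y z α β p-prime p∤r p∤s ord-x≡ ord-y≡
          (subst₂ (λ a b → LCM a b _)
            (ord-^ x (p ℕ.^ α) ord-x≡) (ord-^ y (p ℕ.^ β) ord-y≡) r∨s≡z)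

  ∃-common-order-multiple : ∀ xs → ∃[ g ] All (λ h → ord h ∣ ord g) xs
  ∃-common-order-multiple [] = ε , []
  ∃-common-order-multiple (x ∷ xs) with g , xs∣g ← ∃-common-order-multiple xs
                                   with z , x∨g≡z ← ∃-lcm-order x g =
    z , proj₁ (LCM.commonMultiple x∨g≡z)
      ∷ All.map (λ h∣g → ∣-trans h∣g (proj₂ (LCM.commonMultiple x∨g≡z))) xs∣g

  ∃-exponent-element : ∃[ g ] ∀ h → ord h ∣ ord g
  ∃-exponent-element with g , all∣g ← ∃-common-order-multiple (allFin order) =
    g , λ h → All.lookup all∣g (∈-allFin h)

  module PartialHoms (g : Fin order) where

    -- A homomorphism from a subgroup into ⟨g⟩, presented by discrete logarithms to base g.
    record PartialHom : Set₁ where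
      field
        domain : DecSubmonoid
        log    : Fin order → ℕ

      apply : Fin order → Fin order
      apply a = g ^ log a

      field
        homo : ∀ {a b} → a ∈ domain → b ∈ domain → apply (a ∙ b) ≡ apply a ∙ apply b

      apply-ε : apply ε ≡ ε
      apply-ε = ∙-cancelˡ (apply ε) (apply ε) ε
        (trans (sym (homo (ε-closed domain) (ε-closed domain)))
               (trans (cong apply (identityˡ ε)) (sym (identityʳ (apply ε)))))

      apply-^ : ∀ {a} → a ∈ domain → ∀ k → apply (a ^ k) ≡ apply a ^ k
      apply-^ a∈ zero = apply-ε
      apply-^ a∈ (suc k) =
        trans (homo a∈ (^-closed domain a∈ k)) (cong (apply _ ∙_) (apply-^ a∈ k))

    open PartialHom public

    record _⊑_ (φ ψ : PartialHom) : Set where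
      field
        domain-⊆ : ∀ {a} → a ∈ domain φ → a ∈ domain ψ
        agrees   : ∀ {a} → a ∈ domain φ → apply ψ a ≡ apply φ a

    open _⊑_ public

    ⊑-refl : ∀ {φ} → φ ⊑ φ
    ⊑-refl = record { domain-⊆ = λ a∈ → a∈ ; agrees = λ _ → refl }

    ⊑-trans : ∀ {φ ψ χ} → φ ⊑ ψ → ψ ⊑ χ → φ ⊑ χ
    ⊑-trans φ⊑ψ ψ⊑χ = record
      { domain-⊆ = domain-⊆ ψ⊑χ ∘ domain-⊆ φ⊑ψ
      ; agrees = λ a∈ → trans (agrees ψ⊑χ (domain-⊆ φ⊑ψ a∈)) (agrees φ⊑ψ a∈)
      }

    trivial : PartialHom
    trivial = record
      { domain = record
        { member = _≡ ε
        ; member? = _≟ᶠ ε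
        ; ε-closed = refl
        ; ∙-closed = λ { refl refl → identityˡ ε }
        }
      ; log = λ _ → 0
      ; homo = λ _ _ → sym (identityˡ ε)
      }

    Consistent : PartialHom → Fin order → ℕ → Set
    Consistent φ x t = ∀ k → x ^ k ∈ domain φ → apply φ (x ^ k) ≡ g ^ (t * k)

    module Extension (φ : PartialHom) (x : Fin order) (t : ℕ) (consistent : Consistent φ x t) where

      private
        H : DecSubmonoid
        H = domain φ

      Joined : Pred (Fin order) 0ℓ
      Joined y = ∃₂ λ a j → a ∈ H × y ≡ a ∙ x ^ j

      -- Exponents of x only matter modulo ord x, which bounds the search.
      joined? : Decidable Joined
      joined? y = map′
        (λ (j , _ , a , a∈H , y≡) → a , j , a∈H , y≡)
        (λ (a , j , a∈H , y≡) → j % ord x , m%n<n j (ord x) , a , a∈H ,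
                                trans y≡ (cong (a ∙_) (^-mod-ord x j)))
        (anyUpTo? (λ j → any? (λ a → member? H a ×-dec (y ≟ᶠ a ∙ x ^ j))) (ord x))

      ∙-joined : ∀ a b i j → (a ∙ x ^ i) ∙ (b ∙ x ^ j) ≡ (a ∙ b) ∙ x ^ (i + j)
      ∙-joined a b i j =
        trans (interchange a (x ^ i) b (x ^ j)) (cong ((a ∙ b) ∙_) (sym (^-homo-∙ x i j)))

      WellDefined : ℕ → ℕ → Set
      WellDefined i j = ∀ {a b} → a ∈ H → b ∈ H → a ∙ x ^ i ≡ b ∙ x ^ j →
                        apply φ a ∙ g ^ (t * i) ≡ apply φ b ∙ g ^ (t * j)

      well-defined : ∀ i j → WellDefined i j
      well-defined = wlog ≤-total (λ wd a∈H b∈H eq → sym (wd b∈H a∈H (sym eq))) well-defined≤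
        where
        well-defined≤ : ∀ i j → i ≤ j → WellDefined i j
        well-defined≤ i j i≤j {a} {b} a∈H b∈H a∙xⁱ≡b∙xʲ
          with d , refl ← m≤n⇒∃[o]m+o≡n i≤j = begin
            apply φ a ∙ g ^ (t * i)                ≡⟨ cong (_∙ g ^ (t * i)) φa≡ ⟩
            apply φ b ∙ g ^ (t * d) ∙ g ^ (t * i)  ≡⟨ assoc _ _ _ ⟩
            apply φ b ∙ (g ^ (t * d) ∙ g ^ (t * i))
              ≡⟨ cong (apply φ b ∙_) (^-homo-∙ g (t * d) (t * i)) ⟨
            apply φ b ∙ g ^ (t * d + t * i)        ≡⟨ cong (λ e → apply φ b ∙ g ^ e) t*d+t*i≡ ⟩
            apply φ b ∙ g ^ (t * (i + d))          ∎
          where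
          open ≡-Reasoning
          a≡b∙xᵈ : a ≡ b ∙ x ^ d
          a≡b∙xᵈ = ∙-cancelʳ (x ^ i) a (b ∙ x ^ d) (begin
            a ∙ x ^ i            ≡⟨ a∙xⁱ≡b∙xʲ ⟩
            b ∙ x ^ (i + d)      ≡⟨ cong (λ e → b ∙ x ^ e) (+-comm i d) ⟩
            b ∙ x ^ (d + i)      ≡⟨ cong (b ∙_) (^-homo-∙ x d i) ⟩
            b ∙ (x ^ d ∙ x ^ i)  ≡⟨ assoc b _ _ ⟨
            (b ∙ x ^ d) ∙ x ^ i  ∎)
          xᵈ∈H : x ^ d ∈ H
          xᵈ∈H = subst (_∈ H) (trans (cong (b ⁻¹ ∙_) a≡b∙xᵈ) (\\-leftDividesʳ b (x ^ d)))
                   (∙-closed H (⁻¹-closed H b∈H) a∈H)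
          φa≡ : apply φ a ≡ apply φ b ∙ g ^ (t * d)
          φa≡ = trans (cong (apply φ) a≡b∙xᵈ)
                      (trans (homo φ b∈H xᵈ∈H) (cong (apply φ b ∙_) (consistent d xᵈ∈H)))
          t*d+t*i≡ : t * d + t * i ≡ t * (i + d)
          t*d+t*i≡ = trans (sym (*-distribˡ-+ t d i)) (cong (t *_) (+-comm d i))

      log′ : Fin order → ℕ
      log′ y with joined? y
      ... | yes (a , j , _) = log φ a + t * j
      ... | no _ = 0

      g^log′ : ∀ {y a} j → a ∈ H → y ≡ a ∙ x ^ j → g ^ log′ y ≡ apply φ a ∙ g ^ (t * j)
      g^log′ {y} j a∈H y≡ with joined? y
      ... | yes (b , i , b∈H , y≡′) =
        trans (^-homo-∙ g (log φ b) (t * i)) (well-defined i j b∈H a∈H (trans (sym y≡′) y≡))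
      ... | no ¬joined = contradiction (_ , j , a∈H , y≡) ¬joined

      extension : PartialHom
      extension = record
        { domain = record
          { member = Joined
          ; member? = joined?
          ; ε-closed = ε , 0 , ε-closed H , sym (identityʳ ε)
          ; ∙-closed = λ (a , i , a∈H , y≡) (b , j , b∈H , z≡) →
              a ∙ b , i + j , ∙-closed H a∈H b∈H ,
              trans (cong₂ _∙_ y≡ z≡) (∙-joined a b i j)
          }
        ; log = log′
        ; homo = homo′
        }
        where
        homo′ : ∀ {y z} → Joined y → Joined z →
                g ^ log′ (y ∙ z) ≡ g ^ log′ y ∙ g ^ log′ z
        homo′ {y} {z} (a , i , a∈H , y≡) (b , j , b∈H , z≡) = begin
          g ^ log′ (y ∙ z)
            ≡⟨ g^log′ (i + j) (∙-closed H a∈H b∈H)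
                 (trans (cong₂ _∙_ y≡ z≡) (∙-joined a b i j)) ⟩
          apply φ (a ∙ b) ∙ g ^ (t * (i + j))
            ≡⟨ cong₂ _∙_ (homo φ a∈H b∈H)
                         (trans (cong (g ^_) (*-distribˡ-+ t i j)) (^-homo-∙ g (t * i) (t * j))) ⟩
          (apply φ a ∙ apply φ b) ∙ (g ^ (t * i) ∙ g ^ (t * j))
            ≡⟨ interchange _ _ _ _ ⟩
          (apply φ a ∙ g ^ (t * i)) ∙ (apply φ b ∙ g ^ (t * j))
            ≡⟨ cong₂ _∙_ (g^log′ i a∈H y≡) (g^log′ j b∈H z≡) ⟨
          g ^ log′ y ∙ g ^ log′ z
            ∎
          where open ≡-Reasoning

      φ⊑extension : φ ⊑ extension
      φ⊑extension = record
        { domain-⊆ = λ {a} a∈H → a , 0 , a∈H , sym (identityʳ a)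
        ; agrees = λ {a} a∈H → trans (g^log′ 0 a∈H (sym (identityʳ a)))
            (trans (cong (λ e → apply φ a ∙ g ^ e) (*-zeroʳ t)) (identityʳ _))
        }

      x≡ε∙x¹ : x ≡ ε ∙ x ^ 1
      x≡ε∙x¹ = sym (trans (identityˡ (x ^ 1)) (identityʳ x))

      x∈extension : x ∈ domain extension
      x∈extension = ε , 1 , ε-closed H , x≡ε∙x¹

      extension-x : apply extension x ≡ g ^ t
      extension-x = trans (g^log′ 1 (ε-closed H) x≡ε∙x¹)
                          (trans (cong₂ _∙_ (apply-ε φ) (cong (g ^_) (*-identityʳ t))) (identityˡ _))

    extend : ∀ φ x t → Consistent φ x t →
             ∃[ ψ ] (φ ⊑ ψ × x ∈ domain ψ × apply ψ x ≡ g ^ t)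
    extend φ x t consistent = extension , φ⊑extension , x∈extension , extension-x
      where open Extension φ x t consistent

    module _ (exponent : ∀ h → ord h ∣ ord g) where

      -- For m the order of x modulo domain φ, m divides log φ (x ^ m), since the (ord g / m)-th
      -- power of apply φ (x ^ m) is apply φ (x ^ ord g) = ε.
      consistent-root : ∀ φ x → ∃[ t ] Consistent φ x t
      consistent-root φ x with m , _ , x^k∈H≐ ← relative-order (domain φ) x =
        quotient m∣log , consistent
        where
        open ≡-Reasoning

        xᵐ∈H : x ^ m ∈ domain φ
        xᵐ∈H = proj₂ x^k∈H≐ ∣-refl

        m∣ord-g : m ∣ ord g
        m∣ord-g = proj₁ x^k∈H≐
          (subst (_∈ domain φ) (sym (ord∣⇒^≡ε x (ord g) (exponent x))) (ε-closed (domain φ)))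

        q : ℕ
        q = quotient m∣ord-g

        q≢0 : NonZero q
        q≢0 = m*n≢0⇒m≢0 q {{subst NonZero (m∣n⇒n≡quotient*m m∣ord-g) ord-nonZero}}

        m*q≡ord-g : m * q ≡ ord g
        m*q≡ord-g = trans (*-comm m q) (sym (m∣n⇒n≡quotient*m m∣ord-g))

        m∣log : m ∣ log φ (x ^ m)
        m∣log = *-cancelʳ-∣ q {{q≢0}} (subst (_∣ log φ (x ^ m) * q)
          (sym m*q≡ord-g)
          (^≡ε⇒ord∣ g _ (begin
            g ^ (log φ (x ^ m) * q)   ≡⟨ ^-assocʳ g (log φ (x ^ m)) q ⟨
            apply φ (x ^ m) ^ q       ≡⟨ apply-^ φ xᵐ∈H q ⟨
            apply φ ((x ^ m) ^ q)     ≡⟨ cong (apply φ) (^-assocʳ x m q) ⟩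
            apply φ (x ^ (m * q))     ≡⟨ cong (λ e → apply φ (x ^ e)) m*q≡ord-g ⟩
            apply φ (x ^ ord g)       ≡⟨ cong (apply φ) (ord∣⇒^≡ε x (ord g) (exponent x)) ⟩
            apply φ ε                 ≡⟨ apply-ε φ ⟩
            ε                         ∎)))

        consistent : Consistent φ x (quotient m∣log)
        consistent k xᵏ∈H with divides s refl ← proj₁ x^k∈H≐ {k} xᵏ∈H = begin
          apply φ (x ^ (s * m))         ≡⟨ cong (λ e → apply φ (x ^ e)) (*-comm s m) ⟩
          apply φ (x ^ (m * s))         ≡⟨ cong (apply φ) (^-assocʳ x m s) ⟨
          apply φ ((x ^ m) ^ s)         ≡⟨ apply-^ φ xᵐ∈H s ⟩
          apply φ (x ^ m) ^ s           ≡⟨ ^-assocʳ g (log φ (x ^ m)) s ⟩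
          g ^ (log φ (x ^ m) * s)       ≡⟨ cong (λ e → g ^ (e * s)) (m∣n⇒n≡quotient*m m∣log) ⟩
          g ^ (quotient m∣log * m * s)  ≡⟨ cong (g ^_) (*-assoc (quotient m∣log) m s) ⟩
          g ^ (quotient m∣log * (m * s)) ≡⟨ cong (λ e → g ^ (quotient m∣log * e)) (*-comm m s) ⟩
          g ^ (quotient m∣log * (s * m)) ∎

      extend-to-all : ∀ φ xs → ∃[ ψ ] (φ ⊑ ψ × All (_∈ domain ψ) xs)
      extend-to-all φ [] = φ , ⊑-refl , []
      extend-to-all φ (x ∷ xs) with ψ , φ⊑ψ , xs∈ψ ← extend-to-all φ xs
                               with t , consistent ← consistent-root ψ x
                               with χ , ψ⊑χ , x∈χ , _ ← extend ψ x t consistent =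
        χ , ⊑-trans φ⊑ψ ψ⊑χ , x∈χ ∷ All.map (domain-⊆ ψ⊑χ) xs∈ψ

      g-consistent : Consistent trivial g 1
      g-consistent k gᵏ≡ε = sym (trans (cong (g ^_) (*-identityˡ k)) gᵏ≡ε)

      ∃-retraction : ∃[ ρ ] ((∀ a → a ∈ domain ρ) × apply ρ g ≡ g)
      ∃-retraction
        with φ , _ , g∈φ , φg≡g¹ ← extend trivial g 1 g-consistent
        with ρ , φ⊑ρ , all∈ρ ← extend-to-all φ (allFin order) =
        ρ , (λ a → All.lookup all∈ρ (∈-allFin a)) ,
        trans (agrees φ⊑ρ g∈φ) (trans φg≡g¹ (identityʳ g))

      endomorphism-to : ∀ h → ∃[ f ] (IsEndomorphism G f × f g ≡ h)
      endomorphism-to h with ρ , total , ρg≡g ← ∃-retraction =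
        (λ a → h ^ log ρ a) , homo⇒isEndomorphism homo-h , g↦h
        where
        homo-h : ∀ a b → h ^ log ρ (a ∙ b) ≡ h ^ log ρ a ∙ h ^ log ρ b
        homo-h a b = trans
          (^-transfer g h (exponent h) (log ρ (a ∙ b)) (log ρ a + log ρ b)
            (trans (homo ρ (total a) (total b)) (sym (^-homo-∙ g (log ρ a) (log ρ b)))))
          (^-homo-∙ h (log ρ a) (log ρ b))
        g↦h : h ^ log ρ g ≡ h
        g↦h = trans (^-transfer g h (exponent h) (log ρ g) 1 (trans ρg≡g (sym (identityʳ g))))
                    (identityʳ h)

  open PartialHoms public using (endomorphism-to)

abelian⇒hasSinglePointBasis : (G : FiniteGroup) → IsAbelian G → HasSinglePointBasis G
abelian⇒hasSinglePointBasis G comm =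
  g , λ h h≢g → (h≢g ∘ sym , endomorphism-to g exponent h) ◅ Star.ε
  where
  open FiniteGroup G using (order)
  open FiniteGroupProperties G using (ord)
  open FiniteAbelianGroupProperties G comm
  g : Fin order
  g = proj₁ ∃-exponent-element
  exponent : ∀ h → ord h ∣ ord g
  exponent = proj₂ ∃-exponent-element

module Dihedral where

  open import Data.Fin using (combine; remQuot)
  open import Data.Fin.Patterns using (0F; 1F; 2F; 3F; 4F; 5F; 6F; 7F)
  open import Data.Fin.Properties using (all?)
  open import Data.Nat.DivMod using (_mod_)
  open import Relation.Nullary.Decidable using (True; toWitness)
  open import Algebra.Structures using (IsGroup)

  -- r ^ a ∙ s ^ x is encoded as the number 4 x + a.
  encode : Fin 2 → Fin 4 → Fin 8
  encode = combine

  decode : Fin 8 → Fin 2 × Fin 4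
  decode = remQuot 4

  -- s ^ x ∙ r ^ b = r ^ ((-1) ^ x * b) ∙ s ^ x, and -1 ≡ 3 modulo 4.
  twist : Fin 2 → Fin 4 → ℕ
  twist 0F b = toℕ b
  twist 1F b = 3 * toℕ b

  infixl 7 _·_
  _·_ : Fin 8 → Fin 8 → Fin 8
  k · l with decode k | decode l
  ... | x , a | y , b = encode ((toℕ x + toℕ y) mod 2) ((toℕ a + twist x b) mod 4)

  inv : Fin 8 → Fin 8
  inv k with decode k
  ... | 0F , a = encode 0F ((3 * toℕ a) mod 4)
  ... | 1F , _ = k

  isGroup : IsGroup _≡_ _·_ 0F inv
  isGroup = record
    { isMonoid = record
      { isSemigroup = record
        { isMagma = record { isEquivalence = isEquivalence ; ∙-cong = cong₂ _·_ }
        ; assoc = toWitness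
            {a? = all? λ a → all? λ b → all? λ c → a · b · c ≟ᶠ a · (b · c)} _
        }
      ; identity = toWitness {a? = all? λ a → 0F · a ≟ᶠ a} _
                 , toWitness {a? = all? λ a → a · 0F ≟ᶠ a} _
      }
    ; inverse = toWitness {a? = all? λ a → inv a · a ≟ᶠ 0F} _
              , toWitness {a? = all? λ a → a · inv a ≟ᶠ 0F} _
    ; ⁻¹-cong = cong inv
    }

  D₄ : FiniteGroup
  D₄ = record { order = 8 ; _∙_ = _·_ ; ε = 0F ; _⁻¹ = inv ; isGroup = isGroup }

  r s : Fin 8
  r = encode 0F 1F
  s = encode 1F 0F

  nonabelian : ¬ IsAbelian D₄
  nonabelian comm with () ← comm r s

  -- D₄ → ℤ/2 with kernel ⟨r ^ 2, s⟩, followed by 1 ↦ t: a homomorphism when t ∙ t = ε.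
  via-rotation-parity : Fin 8 → Fin 8 → Fin 8
  via-rotation-parity t k with toℕ (proj₂ (decode k)) mod 2
  ... | 0F = 0F
  ... | 1F = t

  conjugate-by-s : Fin 8 → Fin 8
  conjugate-by-s k = s · k · s

  arc : ∀ {h} (f : Fin 8 → Fin 8) →
        {True (all? λ a → all? λ b → f (a · b) ≟ᶠ f a · f b)} → {True (f r ≟ᶠ h)} →
        h ≢ r → Reachable D₄ r h
  arc f {homo} {r↦h} h≢r =
    (h≢r ∘ sym , f , homo⇒isEndomorphism (toWitness homo) , toWitness r↦h) ◅ Star.ε
    where open FiniteGroupProperties D₄ using (homo⇒isEndomorphism)

  hasSinglePointBasis : HasSinglePointBasis D₄
  hasSinglePointBasis = r , reach
    where
    reach : ∀ h → h ≢ r → Reachable D₄ r h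
    reach 1F r≢r = contradiction refl r≢r
    reach 3F = arc conjugate-by-s
    reach 0F = arc (via-rotation-parity 0F)
    reach 2F = arc (via-rotation-parity 2F)
    reach 4F = arc (via-rotation-parity 4F)
    reach 5F = arc (via-rotation-parity 5F)
    reach 6F = arc (via-rotation-parity 6F)
    reach 7F = arc (via-rotation-parity 7F)

theorem2p5 : ((G : FiniteGroup) → IsAbelian G → HasSinglePointBasis G)
    × (∃[ G ] (¬ IsAbelian G × HasSinglePointBasis G))
theorem2p5 = abelian⇒hasSinglePointBasis , D₄ , nonabelian , hasSinglePointBasis
  where open Dihedral
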